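{- Let $\mathbf m=(m_1,m_2,m_3,m_4)\in\mathbb Z^4$ and define $a_{\mathbf m}(n)$ by \[ \sum_{n\ge1}\frac{a_{\mathbf m}(n)}{n^s}=\zeta(s-m_1)\zeta(s-m_3)+\zeta(s-m_2)\zeta(s-m_4)-\zeta(s-m_1)\zeta(s-m_4)-\zeta(s-m_2)\zeta(s-m_3) \] (for $\Re(s)$ sufficiently large). Then $\operatorname{sgn}(a_{\mathbf m}(n))=\operatorname{sgn}(m_2-m_1)\operatorname{sgn}(m_4-m_3)$ for every composite number $n$.
   Context: $\zeta$ is the Riemann zeta function; $\operatorname{sgn}(x)\in\{ -1,0,1\}$ is the sign of the real number $x$. -}

module Defs where

open import Data.Nat as ℕ using (ℕ; zero; suc; NonZero)
open import Data.Nat.Properties using (m^n≢0)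
open import Data.Nat.Divisibility using (_∣?_)
open import Data.Integer as ℤ using (ℤ; +_; -[1+_])
open import Data.Rational as ℚ using (ℚ; 0ℚ)
open import Data.Rational.Properties using (_<?_)
open import Relation.Nullary using (yes; no)

-- d ^ e for a positive natural d and an integer exponent e, as a rational.
-- The base is written as (suc i), i.e. d = i + 1 ≥ 1.
powℤ : (i : ℕ) → ℤ → ℚ
powℤ i (+ k)     = (+ (suc i ℕ.^ k)) ℚ./ 1
powℤ i -[1+ k ]  = ℚ._/_ (+ 1) (suc i ℕ.^ suc k) {{m^n≢0 (suc i) (suc k)}}

-- Dirichlet coefficient of ζ(s-a)ζ(s-b):
--   c_{a,b}(n) = Σ_{d ∣ n} d^a (n/d)^b   (n ≥ 1; value 0 at n = 0, unused).
-- We sum over d = suc i, i < n, keeping only divisors of n.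
zetaProdCoeff : ℤ → ℤ → ℕ → ℚ
zetaProdCoeff a b n = go n
  where
  go : ℕ → ℚ
  go zero = 0ℚ
  go (suc i) with suc i ∣? n
  ... | yes _ = powℤ i a ℚ.* powℤ' (n ℕ./ suc i) b ℚ.+ go i
    where
    powℤ' : ℕ → ℤ → ℚ
    powℤ' zero    _ = 0ℚ   -- unreachable: n / d ≥ 1 when d ∣ n, n ≥ 1
    powℤ' (suc j) e = powℤ j e
  ... | no _  = go i

aCoeff : ℤ → ℤ → ℤ → ℤ → ℕ → ℚ
aCoeff m₁ m₂ m₃ m₄ n =
  ((zetaProdCoeff m₁ m₃ n ℚ.+ zetaProdCoeff m₂ m₄ n)
    ℚ.- zetaProdCoeff m₁ m₄ n) ℚ.- zetaProdCoeff m₂ m₃ n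

sgnℤ : ℤ → ℤ
sgnℤ (+ zero)   = + 0
sgnℤ (+ suc _)  = + 1
sgnℤ -[1+ _ ]   = -[1+ 0 ]

sgnℚ : ℚ → ℤ
sgnℚ q with q <? 0ℚ
... | yes _ = -[1+ 0 ]
... | no _ with 0ℚ <? q
...   | yes _ = + 1
...   | no _  = + 0

{-# OPTIONS --safe #-}
-- The coefficient of ζ(s - a) ζ(s - b) at n is Σ_{d e = n} d^a e^b, so the four products combine into
--   a_m(n) = Σ_{d e = n} (d^m₁ - d^m₂) (e^m₃ - e^m₄).
-- For m₁ < m₂ and m₃ < m₄ both factors are ≤ 0, so every term is ≥ 0, and a factorisation n = d e with
-- d, e ≥ 2, which exists when n is composite, makes both factors < 0 and its term > 0. Swapping m₁ with m₂,
-- or m₃ with m₄, negates a_m(n) (so a_m(n) = 0 when they coincide), which gives the other sign patterns.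
module Submission where

open import Defs
open import Data.Nat as ℕ using (ℕ; zero; suc; NonZero; s≤s; z<s)
import Data.Nat.Properties as ℕP
open import Data.Nat.Divisibility using (_∣_; _∣?_; m∣m*n; quotient; quotient>1; m∣n⇒n≡m*quotient)
open import Data.Nat.DivMod using (m*[n/m]≡n; m*n/n≡m)
open import Data.Nat.Primality using (Composite)
open import Data.Nat.Divisibility.Core using (hasNonTrivialDivisor)
open import Data.Integer as ℤ using (ℤ; +_; +0; +[1+_]; -[1+_]; 0ℤ; 1ℤ; -1ℤ; +<+; -<+; -<-)
import Data.Integer.Properties as ℤP
open import Data.Rational as ℚ using (ℚ; 0ℚ; 1ℚ; _+_; _-_; _*_; -_; _/_; _<_; _≤_; fromℚᵘ)
import Data.Rational.Properties as ℚP
import Data.Rational.Unnormalised as ℚᵘ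
import Data.Rational.Unnormalised.Properties as ℚᵘP
open import Data.Rational.Solver using (module +-*-Solver)
open import Data.Product using (∃₂; _×_; _,_)
open import Data.Sum using (inj₁; inj₂)
open import Relation.Nullary using (yes; no; contradiction)
open import Relation.Binary using (tri<; tri≈; tri>)
open import Relation.Binary.PropositionalEquality
open import Algebra.Definitions (_≡_ {A = ℚ}) using (Interchangable)
open import Algebra.Bundles using (CommutativeMonoid)
open import Algebra.Properties.CommutativeSemigroup using (interchange)

-- 0 ^ℤ e = 0 is a junk value, the same one zetaProdCoeff uses for n / d = 0.
_^ℤ_ : ℕ → ℤ → ℚ
zero  ^ℤ _ = 0ℚ
suc i ^ℤ e = powℤ i e

fromℚᵘ-mono-< : ∀ {p q} → p ℚᵘ.< q → fromℚᵘ p < fromℚᵘ q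
fromℚᵘ-mono-< {p} {q} p<q = ℚP.toℚᵘ-cancel-<
  (ℚᵘP.<-respˡ-≃ (ℚᵘP.≃-sym (ℚP.toℚᵘ-fromℚᵘ p))
  (ℚᵘP.<-respʳ-≃ (ℚᵘP.≃-sym (ℚP.toℚᵘ-fromℚᵘ q)) p<q))

a*d<c*b⇒a/b<c/d : ∀ a b c d .{{_ : NonZero b}} .{{_ : NonZero d}} →
                  a ℕ.* d ℕ.< c ℕ.* b → + a / b < + c / d
a*d<c*b⇒a/b<c/d a b@(suc b-1) c d@(suc d-1) ad<cb =
  fromℚᵘ-mono-< {ℚᵘ.mkℚᵘ (+ a) b-1} {ℚᵘ.mkℚᵘ (+ c) d-1}
    (ℚᵘ.*<* (subst₂ ℤ._<_ (ℤP.pos-* a d) (ℤP.pos-* c b) (+<+ ad<cb)))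

1^ℤe≡1 : ∀ e → 1 ^ℤ e ≡ 1ℚ
1^ℤe≡1 (+ k)    = cong (λ x → + x / 1) (ℕP.^-zeroˡ k)
1^ℤe≡1 -[1+ k ] =
  ℚP./-cong {+ 1} {1 ℕ.^ suc k} {+ 1} {1} {{ℕP.m^n≢0 1 (suc k)}} refl (ℕP.^-zeroˡ (suc k))

^ℤ-monoʳ-< : ∀ {d e e′} → 1 ℕ.< d → e ℤ.< e′ → d ^ℤ e < d ^ℤ e′
^ℤ-monoʳ-< {d@(suc _)} {+ k} {+ k′} 1<d (+<+ k<k′) =
  a*d<c*b⇒a/b<c/d (d ℕ.^ k) 1 (d ℕ.^ k′) 1
  (ℕP.*-monoˡ-< 1 (ℕP.^-monoʳ-< d 1<d k<k′))
^ℤ-monoʳ-< {d@(suc _)} { -[1+ k ]} {+ k′} 1<d -<+ =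
  a*d<c*b⇒a/b<c/d 1 (d ℕ.^ suc k) (d ℕ.^ k′) 1 {{ℕP.m^n≢0 d (suc k)}}
  (ℕP.<-≤-trans (ℕP.^-monoʳ-< d 1<d {0} {suc k} z<s) (ℕP.m≤n*m _ (d ℕ.^ k′) {{ℕP.m^n≢0 d k′}}))
^ℤ-monoʳ-< {d@(suc _)} { -[1+ k ]} { -[1+ k′ ]} 1<d (-<- k′<k) =
  a*d<c*b⇒a/b<c/d 1 (d ℕ.^ suc k) 1 (d ℕ.^ suc k′) {{ℕP.m^n≢0 d (suc k)}} {{ℕP.m^n≢0 d (suc k′)}}
  (ℕP.*-monoʳ-< 1 (ℕP.^-monoʳ-< d 1<d (s≤s k′<k)))

^ℤ-monoʳ-≤ : ∀ d {e e′} → e ℤ.≤ e′ → d ^ℤ e ≤ d ^ℤ e′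
^ℤ-monoʳ-≤ zero             _ = ℚP.≤-refl
^ℤ-monoʳ-≤ (suc zero) {e} {e′} _ = ℚP.≤-reflexive (trans (1^ℤe≡1 e) (sym (1^ℤe≡1 e′)))
^ℤ-monoʳ-≤ (suc (suc _)) {e} {e′} e≤e′ with e ℤ.≟ e′
... | yes refl = ℚP.≤-refl
... | no e≢e′  = ℚP.<⇒≤ (^ℤ-monoʳ-< ℕ.sz<ss (ℤP.≤∧≢⇒< e≤e′ e≢e′))

p≤q⇒p-q≤0 : ∀ {p q} → p ≤ q → p - q ≤ 0ℚ
p≤q⇒p-q≤0 {p} {q} p≤q = subst (p - q ≤_) (ℚP.+-inverseʳ q) (ℚP.+-monoˡ-≤ (- q) p≤q)

p<q⇒p-q<0 : ∀ {p q} → p < q → p - q < 0ℚ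
p<q⇒p-q<0 {p} {q} p<q = subst (p - q <_) (ℚP.+-inverseʳ q) (ℚP.+-monoˡ-< (- q) p<q)

p≤0∧q≤0⇒0≤p*q : ∀ {p q} → p ≤ 0ℚ → q ≤ 0ℚ → 0ℚ ≤ p * q
p≤0∧q≤0⇒0≤p*q {p} {q} p≤0 q≤0 = ℚP.nonNegative⁻¹ _
  {{ℚP.nonPos*nonPos⇒nonPos p {{ℚ.nonPositive p≤0}} q {{ℚ.nonPositive q≤0}}}}

p<0∧q<0⇒0<p*q : ∀ {p q} → p < 0ℚ → q < 0ℚ → 0ℚ < p * q
p<0∧q<0⇒0<p*q {p} {q} p<0 q<0 = ℚP.positive⁻¹ _
  {{ℚP.neg*neg⇒pos p {{ℚ.negative p<0}} q {{ℚ.negative q<0}}}}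

divisorSum : (ℕ → ℕ → ℚ) → ℕ → ℕ → ℚ
divisorSum f n zero = 0ℚ
divisorSum f n (suc k) with suc k ∣? n
... | yes _ = f (suc k) (n ℕ./ suc k) + divisorSum f n k
... | no _  = divisorSum f n k

divisorSum-zipWith : ∀ (_∙_ : ℚ → ℚ → ℚ) → 0ℚ ∙ 0ℚ ≡ 0ℚ → Interchangable _∙_ _+_ →
                     ∀ {f g h n} → (∀ d e → h d e ≡ f d e ∙ g d e) →
                     ∀ k → divisorSum h n k ≡ divisorSum f n k ∙ divisorSum g n k
divisorSum-zipWith _∙_ 0∙0≡0 _ _ zero = sym 0∙0≡0
divisorSum-zipWith _∙_ 0∙0≡0 ∙-+-interchange {f} {g} {h} {n} h≡f∙g (suc k) with suc k ∣? n
... | yes _ = begin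
  h (suc k) q + divisorSum h n k
    ≡⟨ cong₂ _+_ (h≡f∙g (suc k) q) (divisorSum-zipWith _∙_ 0∙0≡0 ∙-+-interchange h≡f∙g k) ⟩
  (f (suc k) q ∙ g (suc k) q) + (divisorSum f n k ∙ divisorSum g n k)
    ≡⟨ ∙-+-interchange (f (suc k) q) (divisorSum f n k) (g (suc k) q) (divisorSum g n k) ⟨
  (f (suc k) q + divisorSum f n k) ∙ (g (suc k) q + divisorSum g n k) ∎
  where open ≡-Reasoning; q = n ℕ./ suc k
... | no _ = divisorSum-zipWith _∙_ 0∙0≡0 ∙-+-interchange h≡f∙g k

module _ {f : ℕ → ℕ → ℚ} {n : ℕ} (f-nonNeg : ∀ d e → d ℕ.* e ≡ n → 0ℚ ≤ f d e) where

  divisorSum≥0 : ∀ k → 0ℚ ≤ divisorSum f n k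
  divisorSum≥0 zero = ℚP.≤-refl
  divisorSum≥0 (suc k) with suc k ∣? n
  ... | yes k+1∣n = ℚP.+-mono-≤ (f-nonNeg _ _ (m*[n/m]≡n k+1∣n)) (divisorSum≥0 k)
  ... | no _      = divisorSum≥0 k

  divisorSum-≤-suc : ∀ k → divisorSum f n k ≤ divisorSum f n (suc k)
  divisorSum-≤-suc k with suc k ∣? n
  ... | yes k+1∣n = begin
    divisorSum f n k                           ≡⟨ ℚP.+-identityˡ _ ⟨
    0ℚ + divisorSum f n k                      ≤⟨ ℚP.+-monoˡ-≤ _ (f-nonNeg _ _ (m*[n/m]≡n k+1∣n)) ⟩
    f (suc k) (n ℕ./ suc k) + divisorSum f n k ∎
    where open ℚP.≤-Reasoning
  ... | no _ = ℚP.≤-refl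

  divisorSum>0 : ∀ {d e k} → d ℕ.* e ≡ n → 0ℚ < f d e → 0 ℕ.< d → d ℕ.≤ k →
                   0ℚ < divisorSum f n k
  divisorSum>0 {suc i} {e} {suc k} de≡n 0<f _ d≤k+1 with ℕP.m≤n⇒m<n∨m≡n d≤k+1
  ... | inj₁ (s≤s d≤k) = ℚP.<-≤-trans (divisorSum>0 de≡n 0<f z<s d≤k) (divisorSum-≤-suc k)
  ... | inj₂ refl with suc i ∣? n
  ...   | no  d∤n = contradiction (subst (suc i ∣_) de≡n (m∣m*n e)) d∤n
  ...   | yes _   = begin-strict
    0ℚ                                       <⟨ ℚP.+-mono-<-≤ 0<f (divisorSum≥0 i) ⟩
    f (suc i) e + divisorSum f n i           ≡⟨ cong (λ e → f (suc i) e + divisorSum f n i) n/d≡e ⟨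
    f (suc i) (n ℕ./ suc i) + divisorSum f n i ∎
    where
    open ℚP.≤-Reasoning
    n/d≡e : n ℕ./ suc i ≡ e
    n/d≡e = trans (cong (ℕ._/ suc i) (trans (sym de≡n) (ℕP.*-comm (suc i) e))) (m*n/n≡m e (suc i))

-- zetaProdCoeff a b n unfolds to go n, where the where-bound recursion go over the candidate divisors
-- cannot be named. zetaProdCoeffUpTo a b n is that go: the metavariable is solved by unification in the
-- last clause of zetaProdCoeffUpTo-determined, once n has been generalised away from the index.
mutual
  zetaProdCoeffUpTo : ℤ → ℤ → ℕ → ℕ → ℚ
  zetaProdCoeffUpTo = _

  private
    zetaProdCoeffUpTo-determined : ∀ a b m → zetaProdCoeff a b (suc m) ≡ zetaProdCoeff a b (suc m)
    zetaProdCoeffUpTo-determined a b m with suc m ∣? suc m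
    ... | yes _ = refl
    ... | no _ with suc m
    ...   | n = refl {x = zetaProdCoeffUpTo a b n m}

zetaProdCoeffUpTo≡divisorSum : ∀ a b n k →
  zetaProdCoeffUpTo a b n k ≡ divisorSum (λ d e → d ^ℤ a * e ^ℤ b) n k
zetaProdCoeffUpTo≡divisorSum a b n zero = refl
zetaProdCoeffUpTo≡divisorSum a b n (suc k) with suc k ∣? n
... | no _ = zetaProdCoeffUpTo≡divisorSum a b n k
... | yes _ with n ℕ./ suc k   -- zetaProdCoeff's own power of n / d agrees with _^ℤ_ only case by case
...   | zero  = cong (_+_ (powℤ k a * 0ℚ)) (zetaProdCoeffUpTo≡divisorSum a b n k)
...   | suc q = cong (_+_ (powℤ k a * powℤ q b)) (zetaProdCoeffUpTo≡divisorSum a b n k)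

zetaProdCoeff≡divisorSum : ∀ a b n → zetaProdCoeff a b n ≡ divisorSum (λ d e → d ^ℤ a * e ^ℤ b) n n
zetaProdCoeff≡divisorSum a b n = zetaProdCoeffUpTo≡divisorSum a b n n

aTerm : ℤ → ℤ → ℤ → ℤ → ℕ → ℕ → ℚ
aTerm m₁ m₂ m₃ m₄ d e = (d ^ℤ m₁ - d ^ℤ m₂) * (e ^ℤ m₃ - e ^ℤ m₄)

aCoeff≡divisorSum : ∀ m₁ m₂ m₃ m₄ n → aCoeff m₁ m₂ m₃ m₄ n ≡ divisorSum (aTerm m₁ m₂ m₃ m₄) n n
aCoeff≡divisorSum m₁ m₂ m₃ m₄ n = begin
  aCoeff m₁ m₂ m₃ m₄ n
    ≡⟨ cong₂ _-_ (cong₂ _-_ (cong₂ _+_ (Z m₁ m₃) (Z m₂ m₄)) (Z m₁ m₄)) (Z m₂ m₃) ⟩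
  ((S (t m₁ m₃) + S (t m₂ m₄)) - S (t m₁ m₄)) - S (t m₂ m₃)
    ≡⟨ cong (_- S (t m₂ m₃)) (cong (_- S (t m₁ m₄)) (divisorSum-zipWith _+_ refl +-interchange (λ _ _ → refl) n)) ⟨
  (S (λ d e → t m₁ m₃ d e + t m₂ m₄ d e) - S (t m₁ m₄)) - S (t m₂ m₃)
    ≡⟨ cong (_- S (t m₂ m₃)) (divisorSum-zipWith _-_ refl −-+-interchange (λ _ _ → refl) n) ⟨
  S (λ d e → (t m₁ m₃ d e + t m₂ m₄ d e) - t m₁ m₄ d e) - S (t m₂ m₃)
    ≡⟨ divisorSum-zipWith _-_ refl −-+-interchange factorise n ⟨
  S (aTerm m₁ m₂ m₃ m₄) ∎
  where
  open ≡-Reasoning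
  open +-*-Solver
  S : (ℕ → ℕ → ℚ) → ℚ
  S f = divisorSum f n n
  t : ℤ → ℤ → ℕ → ℕ → ℚ
  t a b d e = d ^ℤ a * e ^ℤ b
  Z : ∀ a b → zetaProdCoeff a b n ≡ S (t a b)
  Z a b = zetaProdCoeff≡divisorSum a b n
  +-interchange : Interchangable _+_ _+_
  +-interchange = interchange (CommutativeMonoid.commutativeSemigroup ℚP.+-0-commutativeMonoid)
  −-+-interchange : Interchangable _-_ _+_
  −-+-interchange = solve 4 (λ w x y z → (w :+ x) :- (y :+ z) := (w :- y) :+ (x :- z)) refl
  factorise : ∀ d e → aTerm m₁ m₂ m₃ m₄ d e ≡ ((t m₁ m₃ d e + t m₂ m₄ d e) - t m₁ m₄ d e) - t m₂ m₃ d e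
  factorise d e = solve 4 (λ x₁ x₂ y₃ y₄ → (x₁ :- x₂) :* (y₃ :- y₄) :=
                                         ((x₁ :* y₃ :+ x₂ :* y₄) :- x₁ :* y₄) :- x₂ :* y₃)
                    refl (d ^ℤ m₁) (d ^ℤ m₂) (e ^ℤ m₃) (e ^ℤ m₄)

composite⇒factorisation : ∀ {n} → Composite n → ∃₂ λ d e → 1 ℕ.< d × 1 ℕ.< e × d ℕ.* e ≡ n
composite⇒factorisation (hasNonTrivialDivisor {d} d<n d∣n) =
  d , quotient d∣n , ℕ.nonTrivial⇒n>1 d , quotient>1 d∣n d<n , sym (m∣n⇒n≡m*quotient d∣n)

aCoeff>0 : ∀ {m₁ m₂ m₃ m₄} n → m₁ ℤ.< m₂ → m₃ ℤ.< m₄ → Composite n → 0ℚ < aCoeff m₁ m₂ m₃ m₄ n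
aCoeff>0 {m₁} {m₂} {m₃} {m₄} n m₁<m₂ m₃<m₄ n-composite
  with d , e , 1<d , 1<e , de≡n ← composite⇒factorisation n-composite =
  subst (0ℚ <_) (sym (aCoeff≡divisorSum m₁ m₂ m₃ m₄ n))
    (divisorSum>0 aTerm≥0 de≡n aTerm>0 (ℕP.<-trans z<s 1<d) d≤n)
  where
  aTerm≥0 : ∀ d e → d ℕ.* e ≡ n → 0ℚ ≤ aTerm m₁ m₂ m₃ m₄ d e
  aTerm≥0 d e _ = p≤0∧q≤0⇒0≤p*q
    (p≤q⇒p-q≤0 (^ℤ-monoʳ-≤ d (ℤP.<⇒≤ m₁<m₂))) (p≤q⇒p-q≤0 (^ℤ-monoʳ-≤ e (ℤP.<⇒≤ m₃<m₄)))
  aTerm>0 : 0ℚ < aTerm m₁ m₂ m₃ m₄ d e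
  aTerm>0 = p<0∧q<0⇒0<p*q
    (p<q⇒p-q<0 (^ℤ-monoʳ-< 1<d m₁<m₂)) (p<q⇒p-q<0 (^ℤ-monoʳ-< 1<e m₃<m₄))
  d≤n : d ℕ.≤ n
  d≤n = subst (d ℕ.≤_) de≡n (ℕP.m≤m*n d e {{ℕ.>-nonZero (ℕP.<-trans z<s 1<e)}})

aCoeff-swap₁₂ : ∀ m₁ m₂ m₃ m₄ n → aCoeff m₂ m₁ m₃ m₄ n ≡ - aCoeff m₁ m₂ m₃ m₄ n
aCoeff-swap₁₂ m₁ m₂ m₃ m₄ n =
  solve 4 (λ z₁₃ z₂₄ z₁₄ z₂₃ → ((z₂₃ :+ z₁₄) :- z₂₄) :- z₁₃ := :- (((z₁₃ :+ z₂₄) :- z₁₄) :- z₂₃))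
    refl (zetaProdCoeff m₁ m₃ n) (zetaProdCoeff m₂ m₄ n) (zetaProdCoeff m₁ m₄ n) (zetaProdCoeff m₂ m₃ n)
  where open +-*-Solver

aCoeff-swap₃₄ : ∀ m₁ m₂ m₃ m₄ n → aCoeff m₁ m₂ m₄ m₃ n ≡ - aCoeff m₁ m₂ m₃ m₄ n
aCoeff-swap₃₄ m₁ m₂ m₃ m₄ n =
  solve 4 (λ z₁₃ z₂₄ z₁₄ z₂₃ → ((z₁₄ :+ z₂₃) :- z₁₃) :- z₂₄ := :- (((z₁₃ :+ z₂₄) :- z₁₄) :- z₂₃))
    refl (zetaProdCoeff m₁ m₃ n) (zetaProdCoeff m₂ m₄ n) (zetaProdCoeff m₁ m₄ n) (zetaProdCoeff m₂ m₃ n)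
  where open +-*-Solver

0<p⇒sgnℚp≡1 : ∀ {p} → 0ℚ < p → sgnℚ p ≡ 1ℤ
0<p⇒sgnℚp≡1 {p} 0<p with p ℚP.<? 0ℚ
... | yes p<0 = contradiction p<0 (ℚP.<-asym 0<p)
... | no _ with 0ℚ ℚP.<? p
...   | yes _   = refl
...   | no 0≮p  = contradiction 0<p 0≮p

p<0⇒sgnℚp≡-1 : ∀ {p} → p < 0ℚ → sgnℚ p ≡ -1ℤ
p<0⇒sgnℚp≡-1 {p} p<0 with p ℚP.<? 0ℚ
... | yes _   = refl
... | no p≮0  = contradiction p<0 p≮0

sgnℚ-neg : ∀ p → sgnℚ (- p) ≡ ℤ.- sgnℚ p
sgnℚ-neg p with ℚP.<-cmp p 0ℚ
... | tri< p<0 _ _ = trans (0<p⇒sgnℚp≡1 (ℚP.neg-antimono-< p<0)) (cong ℤ.-_ (sym (p<0⇒sgnℚp≡-1 p<0)))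
... | tri≈ _ refl _ = refl
... | tri> _ _ 0<p = trans (p<0⇒sgnℚp≡-1 (ℚP.neg-antimono-< 0<p)) (cong ℤ.-_ (sym (0<p⇒sgnℚp≡1 0<p)))

i≡-i⇒i≡0 : ∀ {i} → i ≡ ℤ.- i → i ≡ 0ℤ
i≡-i⇒i≡0 {+0} _ = refl

0<i⇒sgnℤi≡1 : ∀ {i} → 0ℤ ℤ.< i → sgnℤ i ≡ 1ℤ
0<i⇒sgnℤi≡1 {+[1+ _ ]} _ = refl
0<i⇒sgnℤi≡1 {+0} (+<+ ())

i<0⇒sgnℤi≡-1 : ∀ {i} → i ℤ.< 0ℤ → sgnℤ i ≡ -1ℤ
i<0⇒sgnℤi≡-1 { -[1+ _ ]} _ = refl
i<0⇒sgnℤi≡-1 {+ _} (+<+ ())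

i<j⇒sgnℤ[j-i]≡1 : ∀ {i j} → i ℤ.< j → sgnℤ (j ℤ.- i) ≡ 1ℤ
i<j⇒sgnℤ[j-i]≡1 {i} {j} i<j =
  0<i⇒sgnℤi≡1 (subst (ℤ._< j ℤ.- i) (ℤP.+-inverseʳ i) (ℤP.+-monoˡ-< (ℤ.- i) i<j))

j<i⇒sgnℤ[j-i]≡-1 : ∀ {i j} → j ℤ.< i → sgnℤ (j ℤ.- i) ≡ -1ℤ
j<i⇒sgnℤ[j-i]≡-1 {i} {j} j<i =
  i<0⇒sgnℤi≡-1 (subst (j ℤ.- i ℤ.<_) (ℤP.+-inverseʳ i) (ℤP.+-monoˡ-< (ℤ.- i) j<i))

antisymmetric-sgnℚ : ∀ (f : ℤ → ℤ → ℚ) c → (∀ i j → f j i ≡ - f i j) →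
                     (∀ {i j} → i ℤ.< j → sgnℚ (f i j) ≡ c) →
                     ∀ i j → sgnℚ (f i j) ≡ c ℤ.* sgnℤ (j ℤ.- i)
antisymmetric-sgnℚ f c f-antisym f-sgn i j with ℤP.<-cmp i j
... | tri< i<j _ _ = begin
  sgnℚ (f i j)        ≡⟨ f-sgn i<j ⟩
  c                   ≡⟨ ℤP.*-identityʳ c ⟨
  c ℤ.* 1ℤ            ≡⟨ cong (c ℤ.*_) (i<j⇒sgnℤ[j-i]≡1 i<j) ⟨
  c ℤ.* sgnℤ (j ℤ.- i) ∎
  where open ≡-Reasoning
... | tri≈ _ refl _ = begin
  sgnℚ (f i i)        ≡⟨ i≡-i⇒i≡0 (trans (cong sgnℚ (f-antisym i i)) (sgnℚ-neg (f i i))) ⟩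
  0ℤ                  ≡⟨ ℤP.*-zeroʳ c ⟨
  c ℤ.* 0ℤ            ≡⟨ cong (λ k → c ℤ.* sgnℤ k) (ℤP.+-inverseʳ i) ⟨
  c ℤ.* sgnℤ (i ℤ.- i) ∎
  where open ≡-Reasoning
... | tri> _ _ j<i = begin
  sgnℚ (f i j)        ≡⟨ cong sgnℚ (f-antisym j i) ⟩
  sgnℚ (- f j i)      ≡⟨ sgnℚ-neg (f j i) ⟩
  ℤ.- sgnℚ (f j i)    ≡⟨ cong ℤ.-_ (f-sgn j<i) ⟩
  ℤ.- c               ≡⟨ ℤP.-1*i≡-i c ⟨
  -1ℤ ℤ.* c           ≡⟨ ℤP.*-comm -1ℤ c ⟩
  c ℤ.* -1ℤ           ≡⟨ cong (c ℤ.*_) (j<i⇒sgnℤ[j-i]≡-1 j<i) ⟨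
  c ℤ.* sgnℤ (j ℤ.- i) ∎
  where open ≡-Reasoning

lemmaA3 : (m₁ m₂ m₃ m₄ : ℤ) (n : ℕ) → Composite n →
    sgnℚ (aCoeff m₁ m₂ m₃ m₄ n) ≡ sgnℤ (m₂ ℤ.- m₁) ℤ.* sgnℤ (m₄ ℤ.- m₃)
lemmaA3 m₁ m₂ m₃ m₄ n n-composite =
  antisymmetric-sgnℚ (λ i j → aCoeff m₁ m₂ i j n) (sgnℤ (m₂ ℤ.- m₁)) (λ i j → aCoeff-swap₃₄ m₁ m₂ i j n)
    sgn-when-m₃<m₄ m₃ m₄
  where
  sgn-when-m₃<m₄ : ∀ {m₃ m₄} → m₃ ℤ.< m₄ → sgnℚ (aCoeff m₁ m₂ m₃ m₄ n) ≡ sgnℤ (m₂ ℤ.- m₁)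
  sgn-when-m₃<m₄ {m₃} {m₄} m₃<m₄ = trans
    (antisymmetric-sgnℚ (λ i j → aCoeff i j m₃ m₄ n) 1ℤ (λ i j → aCoeff-swap₁₂ i j m₃ m₄ n)
      (λ m₁<m₂ → 0<p⇒sgnℚp≡1 (aCoeff>0 n m₁<m₂ m₃<m₄ n-composite)) m₁ m₂)
    (ℤP.*-identityˡ (sgnℤ (m₂ ℤ.- m₁)))
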